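{- If a numerical semigroup $\Lambda$ is generated by an interval and is Arf, then $\Lambda=\{0\}\cup\{i\in\mathbb{N}_0: i\geq c\}$ for some non-negative integer $c$.
   Context: A numerical semigroup is a subset $\Lambda\subseteq\mathbb{N}_0$ containing $0$, closed under addition, with finite complement in $\mathbb{N}_0$. $\Lambda$ is generated by the interval $\{i,i+1,\dots,j\}$ (integers $1\le i\leq j$) if $\Lambda=\{n_i i+n_{i+1}(i+1)+\dots+n_j j: n_i,\dots,n_j\in\mathbb{N}_0\}$. With enumeration $\lambda:\mathbb{N}_0\to\Lambda$ (the increasing bijection), $\Lambda$ is Arf if $\lambda_a+\lambda_b-\lambda_k\in\Lambda$ for all $a\geq b\geq k$ in $\mathbb{N}_0$. -}

module Defs where

open import Data.Nat using (ℕ; zero; suc; _+_; _*_; _∸_; _≤_; _<_; _≥_)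
open import Data.Fin using (Fin; toℕ)
open import Data.Vec.Functional using (Vector; foldr)
open import Data.Product using (Σ; ∃; _×_; _,_)
open import Relation.Binary.PropositionalEquality using (_≡_)
open import Function.Bundles using (_⇔_)

Subset : Set₁
Subset = ℕ → Set

-- Numerical semigroup: contains 0, closed under +, finite complement
-- (finite complement ⇔ some bound N beyond which everything is in Λ).
record IsNumericalSemigroup (Λ : Subset) : Set where
  field
    zero∈    : Λ 0
    +-closed : ∀ {m n} → Λ m → Λ n → Λ (m + n)
    cofinite : ∃ λ N → ∀ n → N ≤ n → Λ n

sumV : ∀ {k} → Vector ℕ k → ℕ
sumV = foldr _+_ 0

IsIntervalCombination : ℕ → ℕ → ℕ → Set
IsIntervalCombination i j n =
  Σ (Vector ℕ (suc (j ∸ i))) λ c → n ≡ sumV (λ t → c t * (i + toℕ t))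

GeneratedByInterval : Subset → Set
GeneratedByInterval Λ =
  ∃ λ i → ∃ λ j → (1 ≤ i) × (i ≤ j) ×
    (∀ n → Λ n ⇔ IsIntervalCombination i j n)

IsEnumeration : Subset → (ℕ → ℕ) → Set
IsEnumeration Λ λ' =
  (∀ m n → m < n → λ' m < λ' n) ×
  (∀ m → Λ (λ' m)) ×
  (∀ x → Λ x → ∃ λ m → λ' m ≡ x)

-- Arf: λ_a + λ_b - λ_k ∈ Λ for all a ≥ b ≥ k, where λ is the enumeration
-- (quantified over the (unique) enumeration of Λ).
IsArf : Subset → Set
IsArf Λ = ∀ (λ' : ℕ → ℕ) → IsEnumeration Λ λ' →
  ∀ a b k → a ≥ b → b ≥ k → Λ ((λ' a + λ' b) ∸ λ' k)

module Submission where

-- Let Λ be generated by the interval {i,…,j}.  A combination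
-- of k generators lies between k·i and k·j, and conversely every number in
-- [k·i, k·j] is such a combination, so Λ is the union of the blocks
-- [k·i, k·j].  In particular Λ has no elements in (0, i), contains
-- [i, j], and membership in Λ is decidable.
--   If i = j then Λ = iℕ, and cofiniteness forces i = 1.
--   If i < j, the enumeration of Λ starts λ₀ = 0, λ₁ = i, λ₂ = i + 1, so
-- the Arf condition with b = 2, k = 1 says λₐ + 1 ∈ Λ for every a ≥ 2,
-- i.e. Λ is closed under successor above i; hence [i, ∞) ⊆ Λ.
-- In both cases Λ = {0} ∪ [i, ∞), so c = i.
--   The Arf property quantifies over enumerations of Λ, so we also build one:
-- every decidable cofinite set containing 0 has an enumeration (module
-- Enumeration).  The file develops, in order: enumerations of decidable
-- cofinite sets, the first values of an arbitrary enumeration, weighted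
-- sums, the block description of interval semigroups, and the theorem.

open import Defs
open import Data.Nat using (ℕ; zero; suc; _+_; _*_; _∸_; _≤_; _<_; _≥_; z≤n; s≤s; _≤?_; _<?_)
open import Data.Nat.Properties
open import Data.Nat.Divisibility using (divides; ∣1⇒≡1; ∣m+n∣m⇒∣n)
open import Data.Fin using (Fin; toℕ; fromℕ<) renaming (zero to fzero; suc to fsuc)
open import Data.Fin.Properties using (toℕ<n; toℕ-fromℕ<)
open import Data.Vec.Functional using (Vector)
open import Data.Product using (∃; ∃₂; _×_; _,_; proj₁; proj₂)
open import Data.Sum using (_⊎_; inj₁; inj₂)
open import Data.Empty using (⊥-elim)
open import Relation.Nullary using (¬_; yes; no)
open import Relation.Nullary.Decidable using (_×-dec_; map′)
open import Relation.Unary using (Decidable)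
open import Relation.Binary.PropositionalEquality using (_≡_; refl; sym; trans; cong; cong₂; subst; module ≡-Reasoning)
open import Function.Bundles using (_⇔_; mk⇔; Equivalence)
open Equivalence using (to; from)

module Enumeration (P : ℕ → Set) (P? : Decidable P) (P0 : P 0)
                   (N : ℕ) (cofinite : ∀ n → N ≤ n → P n) where

  LeastFrom : ℕ → ℕ → Set
  LeastFrom x y = x ≤ y × P y × (∀ z → x ≤ z → z < y → ¬ P z)

  -- Linear search from x, terminating because x + k is known to lie in P.
  leastFrom : ∀ x k → P (x + k) → ∃ (LeastFrom x)
  leastFrom x zero Pxk =
    x , ≤-refl , subst P (+-identityʳ x) Pxk , λ z x≤z z<x → ⊥-elim (<⇒≱ z<x x≤z)
  leastFrom x (suc k) Pxk with P? x
  ... | yes Px = x , ≤-refl , Px , λ z x≤z z<x → ⊥-elim (<⇒≱ z<x x≤z)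
  ... | no ¬Px with leastFrom (suc x) k (subst P (+-suc x k) Pxk)
  ...   | y , x<y , Py , below-y = y , <⇒≤ x<y , Py , below-y′
    where
    below-y′ : ∀ z → x ≤ z → z < y → ¬ P z
    below-y′ z x≤z z<y with m≤n⇒m<n∨m≡n x≤z
    ... | inj₁ x<z = below-y z x<z z<y
    ... | inj₂ refl = ¬Px

  next : ∀ x → ∃ (LeastFrom (suc x))
  next x = leastFrom (suc x) N (cofinite (suc x + N) (m≤n+m N (suc x)))

  enum : ℕ → ℕ
  enum zero    = 0
  enum (suc m) = let (y , _) = next (enum m) in y

  enum-∈ : ∀ m → P (enum m)
  enum-∈ zero    = P0
  enum-∈ (suc m) = let (_ , _ , Py , _) = next (enum m) in Py

  enum-step : ∀ m → enum m < enum (suc m)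
  enum-step m = let (_ , x<y , _) = next (enum m) in x<y

  enum-gap : ∀ m z → enum m < z → z < enum (suc m) → ¬ P z
  enum-gap m = let (_ , _ , _ , below-y) = next (enum m) in below-y

  enum-strict : ∀ m n → m < n → enum m < enum n
  enum-strict m (suc n) (s≤s m≤n) with m≤n⇒m<n∨m≡n m≤n
  ... | inj₁ m<n  = <-trans (enum-strict m n m<n) (enum-step n)
  ... | inj₂ refl = enum-step m

  bracket : ∀ x → ∃ λ m → enum m ≤ x × x < enum (suc m)
  bracket zero = 0 , ≤-refl , enum-step 0
  bracket (suc x) with bracket x
  ... | m , lo , x<hi with m≤n⇒m<n∨m≡n x<hi
  ...   | inj₁ sx<hi = m , m≤n⇒m≤1+n lo , sx<hi
  ...   | inj₂ sx≡hi =
    suc m , ≤-reflexive (sym sx≡hi) , subst (_< enum (suc (suc m))) (sym sx≡hi) (enum-step (suc m))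

  enum-onto : ∀ x → P x → ∃ λ m → enum m ≡ x
  enum-onto x Px with bracket x
  ... | m , lo , x<hi with m≤n⇒m<n∨m≡n lo
  ...   | inj₁ lo<x = ⊥-elim (enum-gap m x lo<x x<hi Px)
  ...   | inj₂ eq   = m , eq

  isEnumeration : IsEnumeration P enum
  isEnumeration = enum-strict , enum-∈ , enum-onto

module EnumerationProperties {Λ : ℕ → Set} {λ′ : ℕ → ℕ} (isEnum : IsEnumeration Λ λ′) where

  private
    strict = let (s , _ , _) = isEnum in s
    onto   = let (_ , _ , o) = isEnum in o

  monotone : ∀ {m n} → m ≤ n → λ′ m ≤ λ′ n
  monotone {m} {n} m≤n with m≤n⇒m<n∨m≡n m≤n
  ... | inj₁ m<n  = <⇒≤ (strict m n m<n)
  ... | inj₂ refl = ≤-refl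

  reflects-< : ∀ {m n} → λ′ m < λ′ n → m < n
  reflects-< {m} {n} λm<λn with m <? n
  ... | yes m<n = m<n
  ... | no m≮n  = ⊥-elim (<⇒≱ λm<λn (monotone (≮⇒≥ m≮n)))

  first-least : ∀ {x} → Λ x → λ′ 0 ≤ x
  first-least {x} Λx with onto x Λx
  ... | m , refl = monotone z≤n

  next-least : ∀ {k x} → Λ x → λ′ k < x → λ′ (suc k) ≤ x
  next-least {k} {x} Λx λk<x with onto x Λx
  ... | m , refl = monotone (reflects-< λk<x)

weighted-sum-mono : ∀ {m} (c : Vector ℕ m) {g h : Fin m → ℕ} → (∀ t → g t ≤ h t) →
                    sumV (λ t → c t * g t) ≤ sumV (λ t → c t * h t)
weighted-sum-mono {zero}  c g≤h = z≤n
weighted-sum-mono {suc m} c g≤h =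
  +-mono-≤ (*-monoʳ-≤ (c fzero) (g≤h fzero)) (weighted-sum-mono (λ t → c (fsuc t)) (λ t → g≤h (fsuc t)))

weighted-sum-const : ∀ {m} (c : Vector ℕ m) k → sumV (λ t → c t * k) ≡ sumV c * k
weighted-sum-const {zero}  c k = refl
weighted-sum-const {suc m} c k =
  trans (cong (c fzero * k +_) (weighted-sum-const (λ t → c (fsuc t)) k))
        (sym (*-distribʳ-+ k (c fzero) (sumV (λ t → c (fsuc t)))))

sum-zeros : ∀ m → sumV {m} (λ _ → 0) ≡ 0
sum-zeros zero    = refl
sum-zeros (suc m) = sum-zeros m

unit : ∀ {m} → Fin m → Vector ℕ m
unit fzero    fzero    = 1
unit fzero    (fsuc _) = 0
unit (fsuc _) fzero    = 0
unit (fsuc d) (fsuc t) = unit d t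

unit-weighted-sum : ∀ {m} (d : Fin m) (g : Fin m → ℕ) → sumV (λ t → unit d t * g t) ≡ g d
unit-weighted-sum {suc m} fzero g =
  trans (cong (1 * g fzero +_) (sum-zeros m)) (trans (+-identityʳ _) (*-identityˡ (g fzero)))
unit-weighted-sum (fsuc d) g = unit-weighted-sum d (λ t → g (fsuc t))

split-block : ∀ {i j} → i ≤ j → ∀ k n → suc k * i ≤ n → n ≤ suc k * j →
              ∃₂ λ t r → (i ≤ t × t ≤ j) × (k * i ≤ r × r ≤ k * j) × t + r ≡ n
split-block {i} {j} i≤j k n lo hi with n ∸ k * i ≤? j
... | yes t≤j = n ∸ k * i , k * i , (m+n≤o⇒m≤o∸n i lo , t≤j) , (≤-refl , *-monoʳ-≤ k i≤j) , m∸n+n≡m ki≤n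
  where
  ki≤n : k * i ≤ n
  ki≤n = ≤-trans (m≤n+m (k * i) i) lo
... | no t≰j = j , n ∸ j , (i≤j , ≤-refl) , (ki≤n∸j , n∸j≤kj) , m+[n∸m]≡n j≤n
  where
  ki≤n : k * i ≤ n
  ki≤n = ≤-trans (m≤n+m (k * i) i) lo
  j+ki≤n : j + k * i ≤ n
  j+ki≤n = m≤o∸n⇒m+n≤o j ki≤n (<⇒≤ (≰⇒> t≰j))
  j≤n : j ≤ n
  j≤n = ≤-trans (m≤m+n j (k * i)) j+ki≤n
  ki≤n∸j : k * i ≤ n ∸ j
  ki≤n∸j = m+n≤o⇒m≤o∸n (k * i) (subst (_≤ n) (+-comm j (k * i)) j+ki≤n)
  n∸j≤kj : n ∸ j ≤ k * j
  n∸j≤kj = subst (n ∸ j ≤_) (m+n∸m≡n j (k * j)) (∸-monoˡ-≤ j hi)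

module IntervalSemigroup (Λ : ℕ → Set) (ns : IsNumericalSemigroup Λ)
                         (i j : ℕ) (1≤i : 1 ≤ i) (i≤j : i ≤ j)
                         (generated : ∀ n → Λ n ⇔ IsIntervalCombination i j n) where
  open IsNumericalSemigroup ns

  generator : Fin (suc (j ∸ i)) → ℕ
  generator t = i + toℕ t

  generator-≤ : ∀ t → generator t ≤ j
  generator-≤ t = subst (generator t ≤_) (m+[n∸m]≡n i≤j) (+-monoʳ-≤ i (≤-pred (toℕ<n t)))

  -- Every element is in some block [k·i, k·j] (k = number of generators used).
  element-in-block : ∀ {n} → Λ n → ∃ λ k → k * i ≤ n × n ≤ k * j
  element-in-block {n} Λn with to (generated n) Λn
  ... | c , refl =
    sumV c ,
    ≤-trans (≤-reflexive (sym (weighted-sum-const c i))) (weighted-sum-mono c (λ t → m≤m+n i (toℕ t))) ,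
    ≤-trans (weighted-sum-mono c generator-≤) (≤-reflexive (weighted-sum-const c j))

  generator-∈ : ∀ {t} → i ≤ t → t ≤ j → Λ t
  generator-∈ {t} i≤t t≤j = from (generated t) (unit d , sym generator-d≡t)
    where
    d : Fin (suc (j ∸ i))
    d = fromℕ< (s≤s (∸-monoˡ-≤ i t≤j))
    generator-d≡t : sumV (λ s → unit d s * generator s) ≡ t
    generator-d≡t = trans (unit-weighted-sum d generator)
                          (trans (cong (i +_) (toℕ-fromℕ< _)) (m+[n∸m]≡n i≤t))

  block-⊆ : ∀ k {n} → k * i ≤ n → n ≤ k * j → Λ n
  block-⊆ zero    lo hi = subst Λ (sym (n≤0⇒n≡0 hi)) zero∈
  block-⊆ (suc k) lo hi with split-block i≤j k _ lo hi
  ... | t , r , (i≤t , t≤j) , (lo′ , hi′) , refl = +-closed (generator-∈ i≤t t≤j) (block-⊆ k lo′ hi′)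

  positive-≥-i : ∀ {n} → Λ n → 0 < n → i ≤ n
  positive-≥-i Λn 0<n with element-in-block Λn
  ... | zero  , _  , hi = ⊥-elim (<⇒≱ 0<n hi)
  ... | suc k , lo , _  = ≤-trans (m≤m+n i (k * i)) lo

  -- Membership is decidable: only blocks with k ≤ n can contain n.
  Λ? : Decidable Λ
  Λ? n = map′ (λ (k , _ , lo , hi) → block-⊆ k lo hi) in-small-block
              (anyUpTo? (λ k → (k * i ≤? n) ×-dec (n ≤? k * j)) (suc n))
    where
    in-small-block : Λ n → ∃ λ k → k < suc n × k * i ≤ n × n ≤ k * j
    in-small-block Λn with element-in-block Λn
    ... | k , lo , hi = k , s≤s (≤-trans k≤k*i lo) , lo , hi
      where
      k≤k*i : k ≤ k * i
      k≤k*i = subst (_≤ k * i) (*-identityʳ k) (*-monoʳ-≤ k 1≤i)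

  -- With a single generator, Λ = iℕ; since Λ contains the consecutive
  -- numbers N and N + 1, i divides 1.
  single-generator : i ≡ j → i ≡ 1
  single-generator refl with cofinite
  ... | N , cof with element-in-block (cof N ≤-refl) | element-in-block (cof (suc N) (n≤1+n N))
  ...   | k , lo , hi | k′ , lo′ , hi′ = ∣1⇒≡1 (∣m+n∣m⇒∣n i∣N+1 i∣N)
    where
    i∣N = divides k (≤-antisym hi lo)
    i∣N+1 = divides k′ (trans (+-comm N 1) (≤-antisym hi′ lo′))

  unit-generator : i ≡ 1 → ∀ n → Λ n
  unit-generator refl n = block-⊆ n (≤-reflexive (*-identityʳ n))
                                    (subst (_≤ n * j) (*-identityʳ n) (*-monoʳ-≤ n i≤j))

  zero-or-≥-i : ∀ n → Λ n → n ≡ 0 ⊎ i ≤ n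
  zero-or-≥-i zero    _  = inj₁ refl
  zero-or-≥-i (suc n) Λn = inj₂ (positive-≥-i Λn (s≤s z≤n))

  module FirstElements {λ′ : ℕ → ℕ} (isEnum : IsEnumeration Λ λ′) where
    open EnumerationProperties isEnum

    private
      strict = let (s , _ , _) = isEnum in s
      member = let (_ , m , _) = isEnum in m

    λ₀≡0 : λ′ 0 ≡ 0
    λ₀≡0 = n≤0⇒n≡0 (first-least zero∈)

    λ₁≡i : λ′ 1 ≡ i
    λ₁≡i = ≤-antisym (next-least (generator-∈ ≤-refl i≤j) (subst (_< i) (sym λ₀≡0) 1≤i))
                     (positive-≥-i (member 1) (subst (_< λ′ 1) λ₀≡0 (strict 0 1 (s≤s z≤n))))

    λ₂≡1+i : i < j → λ′ 2 ≡ suc i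
    λ₂≡1+i i<j = ≤-antisym (next-least (generator-∈ (n≤1+n i) i<j) (subst (_< suc i) (sym λ₁≡i) ≤-refl))
                           (subst (_< λ′ 2) λ₁≡i (strict 1 2 (s≤s (s≤s z≤n))))

  open Enumeration Λ Λ? zero∈ (proj₁ cofinite) (proj₂ cofinite) using (enum; enum-onto; isEnumeration)

  -- The Arf condition with a ≥ b = 2 ≥ k = 1 reads λₐ + λ₂ − λ₁ = λₐ + 1 ∈ Λ;
  -- every element above i = λ₁ is some λₐ with a ≥ 2.
  successor-closed : IsArf Λ → i < j → ∀ {x} → Λ x → i < x → Λ (suc x)
  successor-closed arf i<j {x} Λx i<x with enum-onto x Λx
  ... | a , refl = subst Λ arf-value (arf enum isEnumeration a 2 1 2≤a (s≤s z≤n))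
    where
    open FirstElements isEnumeration
    open EnumerationProperties isEnumeration using (reflects-<)
    2≤a : 2 ≤ a
    2≤a = reflects-< (subst (_< enum a) (sym λ₁≡i) i<x)
    arf-value : enum a + enum 2 ∸ enum 1 ≡ suc (enum a)
    arf-value = begin
      enum a + enum 2 ∸ enum 1 ≡⟨ cong₂ (λ u v → enum a + u ∸ v) (λ₂≡1+i i<j) λ₁≡i ⟩
      enum a + suc i ∸ i       ≡⟨ cong (_∸ i) (+-suc (enum a) i) ⟩
      suc (enum a) + i ∸ i     ≡⟨ m+n∸n≡m (suc (enum a)) i ⟩
      suc (enum a)             ∎
      where open ≡-Reasoning

  ≥-i-⊆ : IsArf Λ → ∀ n → i ≤ n → Λ n
  ≥-i-⊆ arf n i≤n with m≤n⇒m<n∨m≡n i≤j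
  ... | inj₂ i≡j = unit-generator (single-generator i≡j) n
  ... | inj₁ i<j = from-i n i≤n
    where
    from-i : ∀ n → i ≤ n → Λ n
    from-i n i≤n with m≤n⇒m<n∨m≡n i≤n
    ... | inj₂ refl = generator-∈ ≤-refl i≤j
    from-i (suc m) _ | inj₁ (s≤s i≤m) with m≤n⇒m<n∨m≡n i≤m
    ... | inj₂ refl = generator-∈ (n≤1+n i) i<j
    ... | inj₁ i<m  = successor-closed arf i<j (from-i m i≤m) i<m

mainTheorem6 : (Λ : ℕ → Set) → IsNumericalSemigroup Λ → GeneratedByInterval Λ → IsArf Λ →
    ∃ λ c → ∀ n → Λ n ⇔ (n ≡ 0 ⊎ n ≥ c)
mainTheorem6 Λ ns (i , j , 1≤i , i≤j , generated) arf = i , λ n → mk⇔ (zero-or-≥-i n) (from-cases n)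
  where
  open IsNumericalSemigroup ns using (zero∈)
  open IntervalSemigroup Λ ns i j 1≤i i≤j generated using (zero-or-≥-i; ≥-i-⊆)
  from-cases : ∀ n → n ≡ 0 ⊎ n ≥ i → Λ n
  from-cases n (inj₁ refl) = zero∈
  from-cases n (inj₂ i≤n)  = ≥-i-⊆ arf n i≤n
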